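{- For every positive integer $n$, the graph $K_n\triangleright S_n$ has a pivot-minor isomorphic to $P_{n+1}$.
   Context: $K_n\triangleright S_n$ is the graph on $2n$ vertices $a_1,\dots,a_n,b_1,\dots,b_n$ in which $\{a_1,\dots,a_n\}$ is a clique, $\{b_1,\dots,b_n\}$ is a stable set, and $a_i$ is adjacent to $b_j$ iff $i\ge j$. $P_{n+1}$ is the path on $n+1$ vertices. For a vertex $v$ of $G$, the local complementation $G*v$ is the graph on $V(G)$ in which distinct $x,y$ are adjacent iff exactly one of: both are neighbors of $v$ in $G$; $x$ is adjacent to $y$ in $G$. For an edge $uv$, the pivot is $G\wedge uv=G*u*v*u$. A graph $H$ is a pivot-minor of $G$ if $H$ is obtained from $G$ by a sequence of pivots (at edges) and vertex deletions. -}

module Defs where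

open import Data.Nat using (ℕ; zero; suc; _≤_; _≥_)
open import Data.Bool using (Bool; true; false; _∧_; _xor_; if_then_else_)
open import Data.Bool.Properties using (∧-comm)
open import Data.Fin using (Fin; toℕ; punchIn; _≟_)
open import Relation.Nullary using (yes; no)
open import Relation.Binary.PropositionalEquality using (_≡_; refl; sym; cong₂)
open import Function.Bundles using (_↔_; Inverse)

record Graph : Set where
  field
    size : ℕ
    adj  : Fin size → Fin size → Bool
    adj-sym : ∀ x y → adj x y ≡ adj y x
    adj-irr : ∀ x → adj x x ≡ false
open Graph public

lcAdj : (G : Graph) → Fin (size G) → Fin (size G) → Fin (size G) → Bool
lcAdj G v x y with x ≟ y
... | yes _ = false
... | no  _ = (adj G v x ∧ adj G v y) xor adj G x y

private
  lcAdj-sym : (G : Graph) (v x y : Fin (size G)) → lcAdj G v x y ≡ lcAdj G v y x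
  lcAdj-sym G v x y with x ≟ y | y ≟ x
  ... | yes _ | yes _ = refl
  ... | yes p | no ¬q = Data.Empty.⊥-elim (¬q (sym p))
    where import Data.Empty
  ... | no ¬p | yes q = Data.Empty.⊥-elim (¬p (sym q))
    where import Data.Empty
  ... | no _ | no _ =
    cong₂ _xor_ (∧-comm (adj G v x) (adj G v y)) (adj-sym G x y)

  lcAdj-irr : (G : Graph) (v x : Fin (size G)) → lcAdj G v x x ≡ false
  lcAdj-irr G v x with x ≟ x
  ... | yes _ = refl
  ... | no ¬p = Data.Empty.⊥-elim (¬p refl)
    where import Data.Empty

_*_ : (G : Graph) → Fin (size G) → Graph
G * v = record
  { size = size G
  ; adj = lcAdj G v
  ; adj-sym = lcAdj-sym G v
  ; adj-irr = lcAdj-irr G v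
  }

pivot : (G : Graph) → Fin (size G) → Fin (size G) → Graph
pivot G u v = ((G * u) * v) * u

delete : (G : Graph) {n : ℕ} → size G ≡ suc n → Fin (size G) → Graph
delete record { size = .(suc n) ; adj = a ; adj-sym = s ; adj-irr = i } {n} refl v = record
  { size = n
  ; adj = λ x y → a (punchIn v x) (punchIn v y)
  ; adj-sym = λ x y → s (punchIn v x) (punchIn v y)
  ; adj-irr = λ x → i (punchIn v x)
  }

data PivotMinor (H : Graph) : Graph → Set where
  pm-refl   : PivotMinor H H
  pm-pivot  : ∀ {G} (u v : Fin (size G)) → adj G u v ≡ true →
              PivotMinor H (pivot G u v) → PivotMinor H G
  pm-delete : ∀ {G n} (e : size G ≡ suc n) (v : Fin (size G)) →
              PivotMinor H (delete G e v) → PivotMinor H G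

record _≅_ (G H : Graph) : Set where
  field
    bij : Fin (size G) ↔ Fin (size H)
    preserves : ∀ x y → adj H (Inverse.to bij x) (Inverse.to bij y) ≡ adj G x y

_≤ᵇF_ : ∀ {n} → Fin n → Fin n → Bool
i ≤ᵇF j = Data.Nat._≤ᵇ_ (toℕ i) (toℕ j)
  where import Data.Nat

-- K_n ▷ S_n on Fin (n + n): vertices a_1..a_n are inject+ n i (i : Fin n,
-- a_{i+1}), vertices b_1..b_n are raise n j.  The a's form a clique, the
-- b's a stable set, a_i ~ b_j iff i ≥ j.
open import Data.Fin using (splitAt; _↑ˡ_; _↑ʳ_)
open import Data.Sum using (inj₁; inj₂)
open import Data.Nat using (_+_)

KSAdj : (n : ℕ) → Fin (n + n) → Fin (n + n) → Bool
KSAdj n x y with splitAt n x | splitAt n y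
... | inj₁ i | inj₁ j with i ≟ j
...   | yes _ = false
...   | no  _ = true
KSAdj n x y | inj₁ i | inj₂ j = j ≤ᵇF i
KSAdj n x y | inj₂ i | inj₁ j = i ≤ᵇF j
KSAdj n x y | inj₂ _ | inj₂ _ = false

private
  KSAdj-sym : (n : ℕ) (x y : Fin (n + n)) → KSAdj n x y ≡ KSAdj n y x
  KSAdj-sym n x y with splitAt n x | splitAt n y
  ... | inj₁ i | inj₁ j with i ≟ j | j ≟ i
  ...   | yes _ | yes _ = refl
  ...   | no  _ | no  _ = refl
  ...   | yes p | no ¬q = Data.Empty.⊥-elim (¬q (sym p))
    where import Data.Empty
  ...   | no ¬p | yes q = Data.Empty.⊥-elim (¬p (sym q))
    where import Data.Empty
  KSAdj-sym n x y | inj₁ i | inj₂ j = refl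
  KSAdj-sym n x y | inj₂ i | inj₁ j = refl
  KSAdj-sym n x y | inj₂ _ | inj₂ _ = refl

  KSAdj-irr : (n : ℕ) (x : Fin (n + n)) → KSAdj n x x ≡ false
  KSAdj-irr n x with splitAt n x
  ... | inj₁ i with i ≟ i
  ...   | yes _ = refl
  ...   | no ¬p = Data.Empty.⊥-elim (¬p refl)
    where import Data.Empty
  KSAdj-irr n x | inj₂ i = refl

KS : ℕ → Graph
KS n = record
  { size = n + n ; adj = KSAdj n
  ; adj-sym = KSAdj-sym n ; adj-irr = KSAdj-irr n }

PAdj : (m : ℕ) → Fin m → Fin m → Bool
PAdj m i j = (Data.Nat._≡ᵇ_ (suc (toℕ i)) (toℕ j)) Data.Bool.∨ (Data.Nat._≡ᵇ_ (suc (toℕ j)) (toℕ i))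
  where import Data.Nat ; import Data.Bool

private
  PAdj-sym : (m : ℕ) (i j : Fin m) → PAdj m i j ≡ PAdj m j i
  PAdj-sym m i j = Data.Bool.Properties.∨-comm (Data.Nat._≡ᵇ_ (suc (toℕ i)) (toℕ j)) (Data.Nat._≡ᵇ_ (suc (toℕ j)) (toℕ i))
    where import Data.Bool.Properties ; import Data.Nat

  ≡ᵇ-suc : (k : ℕ) → Data.Nat._≡ᵇ_ (suc k) k ≡ false
  ≡ᵇ-suc zero = refl
  ≡ᵇ-suc (suc k) = ≡ᵇ-suc k

  PAdj-irr : (m : ℕ) (i : Fin m) → PAdj m i i ≡ false
  PAdj-irr m i rewrite ≡ᵇ-suc (toℕ i) = refl

P : ℕ → Graph
P m = record { size = m ; adj = PAdj m ; adj-sym = PAdj-sym m ; adj-irr = PAdj-irr m }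

module Submission where

-- Write a i, b i (i = 0, 1, …) for the vertices a_{i+1}, b_{i+1} and
-- describe graphs by adjacency functions on these labels.  Pivoting the
-- edge a 1 b 1 of K_∞ ▷ S_∞ turns a 0, b 0, b 1 into a triangle hanging
-- off a shifted copy of K_∞ ▷ S_∞; the same pivot on that copy adds the
-- next triangle, so k pivots give a ladder of k rungs on top of K ▷ S,
-- in which b 0, …, b k, a k induce a path.

open import Defs
open import Data.Nat using (ℕ; suc; _≥_)
open import Data.Product using (Σ; _×_)

open import Data.Nat using (zero; _+_; _<_; _≤_; s≤s; s≤s⁻¹; _≡ᵇ_; _≤ᵇ_)
open import Data.Nat.Properties using (≡ᵇ⇒≡; ≡⇒≡ᵇ; 1+n≢n; <⇒≤; n<1+n)
open import Data.Bool using (Bool; true; false; not; _∧_; _∨_; _xor_)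
open import Data.Bool.Properties using (¬-not; T-≡; xor-same; xor-identityʳ; ∧-zeroʳ; ∨-comm)
open import Data.Bool.Solver using (module xor-∧-Solver)
open import Data.Fin using (Fin; zero; suc; toℕ; fromℕ; fromℕ<; punchIn; splitAt; join; _↑ˡ_; _↑ʳ_; _≟_)
open import Data.Fin.Properties using (toℕ-injective; toℕ<n; toℕ-fromℕ; toℕ-fromℕ<; splitAt-↑ˡ; splitAt-↑ʳ; join-splitAt)
open import Data.Fin.Permutation using (Permutation; insert; id; _⟨$⟩ʳ_; insert-punchIn)
open import Data.Product using (_,_; proj₂)
open import Data.Sum using (_⊎_; inj₁; inj₂)
open import Data.Empty using (⊥-elim)
open import Function using (_∘_)
open import Function.Bundles using (Equivalence)
open import Relation.Nullary using (yes; no)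
open import Relation.Binary.Definitions using (DecidableEquality)
open import Relation.Binary.PropositionalEquality
  using (_≡_; _≢_; refl; sym; trans; cong; cong₂; subst₂; ≢-sym; module ≡-Reasoning)
open ≡-Reasoning

pm-trans : ∀ {H G′ G} → PivotMinor H G′ → PivotMinor G′ G → PivotMinor H G
pm-trans H≼G′ pm-refl             = H≼G′
pm-trans H≼G′ (pm-pivot u v e p)  = pm-pivot u v e (pm-trans H≼G′ p)
pm-trans H≼G′ (pm-delete e v p)   = pm-delete e v (pm-trans H≼G′ p)

Adjacency : Set → Set
Adjacency V = V → V → Bool

Symmetric : {V : Set} → Adjacency V → Set
Symmetric r = ∀ x y → r x y ≡ r y x

Irreflexive : {V : Set} → Adjacency V → Set
Irreflexive r = ∀ x → r x x ≡ false

toggled : {V : Set} → Adjacency V → V → V → V → V → Bool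
toggled r u v x y = r x y xor ((r u x ∧ r v y) xor (r v x ∧ r u y))

record IsPivot {V : Set} (r r′ : Adjacency V) (u v : V) : Set where
  field
    edge  : r u v ≡ true
    edge′ : r′ u v ≡ true
    row-u : ∀ y → y ≢ u → y ≢ v → r′ u y ≡ r v y
    row-v : ∀ y → y ≢ u → y ≢ v → r′ v y ≡ r u y
    away  : ∀ x y → x ≢ y → x ≢ u → x ≢ v → y ≢ u → y ≢ v →
            r′ x y ≡ toggled r u v x y
open IsPivot

toggled-unseenˡ : {V : Set} (r : Adjacency V) (u v x y : V) →
                  r u x ≡ false → r v x ≡ false → toggled r u v x y ≡ r x y
toggled-unseenˡ r u v x y ux vx = begin
  r x y xor ((r u x ∧ r v y) xor (r v x ∧ r u y))
    ≡⟨ cong₂ (λ p q → r x y xor ((p ∧ r v y) xor (q ∧ r u y))) ux vx ⟩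
  r x y xor false
    ≡⟨ xor-identityʳ (r x y) ⟩
  r x y ∎

toggled-unseenʳ : {V : Set} (r : Adjacency V) (u v x y : V) →
                  r u y ≡ false → r v y ≡ false → toggled r u v x y ≡ r x y
toggled-unseenʳ r u v x y uy vy = begin
  r x y xor ((r u x ∧ r v y) xor (r v x ∧ r u y))
    ≡⟨ cong₂ (λ p q → r x y xor ((r u x ∧ p) xor (r v x ∧ q))) vy uy ⟩
  r x y xor ((r u x ∧ false) xor (r v x ∧ false))
    ≡⟨ cong₂ (λ p q → r x y xor (p xor q)) (∧-zeroʳ (r u x)) (∧-zeroʳ (r v x)) ⟩
  r x y xor false
    ≡⟨ xor-identityʳ (r x y) ⟩
  r x y ∎

toggled-twins : {V : Set} (r : Adjacency V) (u v x y : V) →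
                r u x ≡ r v x → r u y ≡ r v y → toggled r u v x y ≡ r x y
toggled-twins r u v x y ux≡vx uy≡vy = begin
  r x y xor ((r u x ∧ r v y) xor (r v x ∧ r u y))
    ≡⟨ cong₂ (λ p q → r x y xor ((p ∧ r v y) xor (r v x ∧ q))) ux≡vx uy≡vy ⟩
  r x y xor ((r v x ∧ r v y) xor (r v x ∧ r v y))
    ≡⟨ cong (r x y xor_) (xor-same (r v x ∧ r v y)) ⟩
  r x y xor false
    ≡⟨ xor-identityʳ (r x y) ⟩
  r x y ∎

module _ where
  open xor-∧-Solver

  xor-cancelˡ : ∀ p q → (p xor q) xor p ≡ q
  xor-cancelˡ = solve 2 (λ p q → (p :+ q) :+ p := q) refl

  xor-cancelʳ : ∀ p q → q xor (p xor q) ≡ p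
  xor-cancelʳ = solve 2 (λ p q → q :+ (p :+ q) := p) refl

  three-local-complements : ∀ ux uy vx vy xy →
    ((vx ∧ vy) xor (((ux xor vx) ∧ (uy xor vy)) xor ((ux ∧ uy) xor xy)))
      ≡ (xy xor ((ux ∧ vy) xor (vx ∧ uy)))
  three-local-complements = solve 5 (λ ux uy vx vy xy →
    (vx :* vy) :+ (((ux :+ vx) :* (uy :+ vy)) :+ ((ux :* uy) :+ xy))
      := xy :+ ((ux :* vy) :+ (vx :* uy))) refl

lc-adj : (G : Graph) (w x y : Fin (size G)) → x ≢ y →
         adj (G * w) x y ≡ (adj G w x ∧ adj G w y) xor adj G x y
lc-adj G w x y x≢y with x ≟ y
... | yes x≡y = ⊥-elim (x≢y x≡y)
... | no  _   = refl

lc-own : (G : Graph) (w y : Fin (size G)) → w ≢ y → adj (G * w) w y ≡ adj G w y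
lc-own G w y w≢y =
  trans (lc-adj G w w y w≢y) (cong (λ c → (c ∧ adj G w y) xor adj G w y) (adj-irr G w))

pivot-formula : (G : Graph) (u v : Fin (size G)) → adj G u v ≡ true →
                IsPivot (adj G) (adj (pivot G u v)) u v
pivot-formula G u v uv = record
  { edge = uv ; edge′ = edge′-G ; row-u = row-u-G ; row-v = row-v-G ; away = away-G }
  where
  G₁ = G * u
  G₂ = G₁ * v
  g  = adj G
  g₁ = adj G₁
  g₂ = adj G₂
  g₃ = adj (pivot G u v)

  u≢v : u ≢ v
  u≢v refl with trans (sym (adj-irr G u)) uv
  ... | ()

  g₁-vu : g₁ v u ≡ true
  g₁-vu = trans (adj-sym G₁ v u) (trans (lc-own G u v u≢v) uv)

  g₁-v : ∀ y → y ≢ u → y ≢ v → g₁ v y ≡ g u y xor g v y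
  g₁-v y _ y≢v = trans (lc-adj G u v y (≢-sym y≢v)) (cong (λ c → (c ∧ g u y) xor g v y) uv)

  g₂-u : ∀ y → y ≢ u → y ≢ v → g₂ u y ≡ g v y
  g₂-u y y≢u y≢v = begin
    g₂ u y                             ≡⟨ lc-adj G₁ v u y (≢-sym y≢u) ⟩
    (g₁ v u ∧ g₁ v y) xor g₁ u y       ≡⟨ cong₂ (λ p q → (p ∧ q) xor g₁ u y) g₁-vu (g₁-v y y≢u y≢v) ⟩
    (g u y xor g v y) xor g₁ u y       ≡⟨ cong ((g u y xor g v y) xor_) (lc-own G u y (≢-sym y≢u)) ⟩
    (g u y xor g v y) xor g u y        ≡⟨ xor-cancelˡ (g u y) (g v y) ⟩
    g v y                              ∎

  g₂-v : ∀ y → y ≢ u → y ≢ v → g₂ v y ≡ g u y xor g v y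
  g₂-v y y≢u y≢v = trans (lc-own G₁ v y (≢-sym y≢v)) (g₁-v y y≢u y≢v)

  g₂-uv : g₂ u v ≡ true
  g₂-uv = trans (adj-sym G₂ u v) (trans (lc-own G₁ v u (≢-sym u≢v)) g₁-vu)

  edge′-G : g₃ u v ≡ true
  edge′-G = trans (lc-own G₂ u v u≢v) g₂-uv

  row-u-G : ∀ y → y ≢ u → y ≢ v → g₃ u y ≡ g v y
  row-u-G y y≢u y≢v = trans (lc-own G₂ u y (≢-sym y≢u)) (g₂-u y y≢u y≢v)

  row-v-G : ∀ y → y ≢ u → y ≢ v → g₃ v y ≡ g u y
  row-v-G y y≢u y≢v = begin
    g₃ v y                             ≡⟨ lc-adj G₂ u v y (≢-sym y≢v) ⟩
    (g₂ u v ∧ g₂ u y) xor g₂ v y       ≡⟨ cong₂ (λ p q → (p ∧ q) xor g₂ v y) g₂-uv (g₂-u y y≢u y≢v) ⟩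
    g v y xor g₂ v y                   ≡⟨ cong (g v y xor_) (g₂-v y y≢u y≢v) ⟩
    g v y xor (g u y xor g v y)        ≡⟨ xor-cancelʳ (g u y) (g v y) ⟩
    g u y                              ∎

  away-G : ∀ x y → x ≢ y → x ≢ u → x ≢ v → y ≢ u → y ≢ v → g₃ x y ≡ toggled g u v x y
  away-G x y x≢y x≢u x≢v y≢u y≢v = begin
    g₃ x y
      ≡⟨ lc-adj G₂ u x y x≢y ⟩
    (g₂ u x ∧ g₂ u y) xor g₂ x y
      ≡⟨ cong₂ (λ p q → (p ∧ q) xor g₂ x y) (g₂-u x x≢u x≢v) (g₂-u y y≢u y≢v) ⟩
    (g v x ∧ g v y) xor g₂ x y
      ≡⟨ cong ((g v x ∧ g v y) xor_) (lc-adj G₁ v x y x≢y) ⟩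
    (g v x ∧ g v y) xor ((g₁ v x ∧ g₁ v y) xor g₁ x y)
      ≡⟨ cong₂ (λ p q → (g v x ∧ g v y) xor ((p ∧ q) xor g₁ x y)) (g₁-v x x≢u x≢v) (g₁-v y y≢u y≢v) ⟩
    (g v x ∧ g v y) xor (((g u x xor g v x) ∧ (g u y xor g v y)) xor g₁ x y)
      ≡⟨ cong (λ c → (g v x ∧ g v y) xor (((g u x xor g v x) ∧ (g u y xor g v y)) xor c)) (lc-adj G u x y x≢y) ⟩
    (g v x ∧ g v y) xor (((g u x xor g v x) ∧ (g u y xor g v y)) xor ((g u x ∧ g u y) xor g x y))
      ≡⟨ three-local-complements (g u x) (g u y) (g v x) (g v y) (g x y) ⟩
    toggled g u v x y ∎

module _ {V W : Set} (_≟ᵥ_ : DecidableEquality V) {ℓ : V → W}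
         (ℓ-injective : ∀ {x y} → ℓ x ≡ ℓ y → x ≡ y)
         {g g′ : Adjacency V} {r r′ : Adjacency W} {u v : V}
         (g′-sym : Symmetric g′) (g′-irr : Irreflexive g′)
         (r′-sym : Symmetric r′) (r′-irr : Irreflexive r′)
         (g-pivot : IsPivot g g′ u v) (r-pivot : IsPivot r r′ (ℓ u) (ℓ v))
         (g≈r : ∀ x y → g x y ≡ r (ℓ x) (ℓ y)) where

  private
    ℓ-≢ : ∀ {x y} → x ≢ y → ℓ x ≢ ℓ y
    ℓ-≢ x≢y = x≢y ∘ ℓ-injective

    flipped : ∀ {x y} → g′ y x ≡ r′ (ℓ y) (ℓ x) → g′ x y ≡ r′ (ℓ x) (ℓ y)
    flipped {x} {y} e = trans (g′-sym x y) (trans e (r′-sym (ℓ y) (ℓ x)))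

    row-u≈ : ∀ y → y ≢ u → g′ u y ≡ r′ (ℓ u) (ℓ y)
    row-u≈ y y≢u with y ≟ᵥ v
    ... | yes refl = trans (edge′ g-pivot) (sym (edge′ r-pivot))
    ... | no  y≢v  = trans (row-u g-pivot y y≢u y≢v)
                       (trans (g≈r v y) (sym (row-u r-pivot (ℓ y) (ℓ-≢ y≢u) (ℓ-≢ y≢v))))

    row-v≈ : ∀ y → y ≢ v → g′ v y ≡ r′ (ℓ v) (ℓ y)
    row-v≈ y y≢v with y ≟ᵥ u
    ... | yes refl = flipped (trans (edge′ g-pivot) (sym (edge′ r-pivot)))
    ... | no  y≢u  = trans (row-v g-pivot y y≢u y≢v)
                       (trans (g≈r u y) (sym (row-v r-pivot (ℓ y) (ℓ-≢ y≢u) (ℓ-≢ y≢v))))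

    toggled≈ : ∀ x y → toggled g u v x y ≡ toggled r (ℓ u) (ℓ v) (ℓ x) (ℓ y)
    toggled≈ x y = cong₂ _xor_ (g≈r x y)
      (cong₂ _xor_ (cong₂ _∧_ (g≈r u x) (g≈r v y)) (cong₂ _∧_ (g≈r v x) (g≈r u y)))

  pivot-transfer : ∀ x y → g′ x y ≡ r′ (ℓ x) (ℓ y)
  pivot-transfer x y with x ≟ᵥ y | x ≟ᵥ u | x ≟ᵥ v | y ≟ᵥ u | y ≟ᵥ v
  ... | yes refl | _ | _ | _ | _ = trans (g′-irr x) (sym (r′-irr (ℓ x)))
  ... | no x≢y | yes refl | _ | _ | _ = row-u≈ y (≢-sym x≢y)
  ... | no x≢y | no _ | yes refl | _ | _ = row-v≈ y (≢-sym x≢y)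
  ... | no _ | no x≢u | no _ | yes refl | _ = flipped (row-u≈ x x≢u)
  ... | no _ | no _ | no x≢v | no _ | yes refl = flipped (row-v≈ x x≢v)
  ... | no x≢y | no x≢u | no x≢v | no y≢u | no y≢v =
    trans (away g-pivot x y x≢y x≢u x≢v y≢u y≢v)
      (trans (toggled≈ x y)
        (sym (away r-pivot (ℓ x) (ℓ y) (ℓ-≢ x≢y) (ℓ-≢ x≢u) (ℓ-≢ x≢v) (ℓ-≢ y≢u) (ℓ-≢ y≢v))))

-- Graphs on a fixed vertex set Fin m, so that pivoting keeps the type.
record GraphOn (m : ℕ) : Set where
  field
    rel     : Adjacency (Fin m)
    rel-sym : Symmetric rel
    rel-irr : Irreflexive rel
open GraphOn

graph : ∀ {m} → GraphOn m → Graph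
graph {m} G = record { size = m ; adj = rel G ; adj-sym = rel-sym G ; adj-irr = rel-irr G }

asGraphOn : (G : Graph) → GraphOn (size G)
asGraphOn G = record { rel = adj G ; rel-sym = adj-sym G ; rel-irr = adj-irr G }

pivotOn : ∀ {m} → GraphOn m → Fin m → Fin m → GraphOn m
pivotOn G u v = asGraphOn (pivot (graph G) u v)

Described : ∀ {m} {W : Set} → GraphOn m → (Fin m → W) → Adjacency W → Set
Described G ℓ r = ∀ x y → rel G x y ≡ r (ℓ x) (ℓ y)

pivot-step : ∀ {m} {W : Set} {ℓ : Fin m → W} → (∀ {x y} → ℓ x ≡ ℓ y → x ≡ y) →
             {r r′ : Adjacency W} → Symmetric r′ → Irreflexive r′ →
             (G : GraphOn m) (u v : Fin m) → IsPivot r r′ (ℓ u) (ℓ v) → Described G ℓ r →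
             PivotMinor (graph (pivotOn G u v)) (graph G) × Described (pivotOn G u v) ℓ r′
pivot-step ℓ-injective r′-sym r′-irr G u v r-pivot G≈r =
    pm-pivot u v uv pm-refl
  , pivot-transfer _≟_ ℓ-injective (adj-sym G∧uv) (adj-irr G∧uv) r′-sym r′-irr
      (pivot-formula (graph G) u v uv) r-pivot G≈r
  where
  G∧uv = pivot (graph G) u v
  uv : rel G u v ≡ true
  uv = trans (G≈r u v) (edge r-pivot)

-- Vertex labels: a i is the clique vertex a_{i+1}, b i the stable b_{i+1}.
data Part : Set where
  clique stable : Part

Vertex : Set
Vertex = Part × ℕ

pattern a i = clique , i
pattern b i = stable , i

shift : Vertex → Vertex
shift (p , i) = p , suc i

≡ᵇ-refl : ∀ i → (i ≡ᵇ i) ≡ true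
≡ᵇ-refl i = Equivalence.to T-≡ (≡⇒≡ᵇ i i refl)

≡ᵇ-false : ∀ {i j} → i ≢ j → (i ≡ᵇ j) ≡ false
≡ᵇ-false {i} {j} i≢j = ¬-not (i≢j ∘ ≡ᵇ⇒≡ i j ∘ Equivalence.from T-≡)

≡ᵇ-sym : ∀ i j → (i ≡ᵇ j) ≡ (j ≡ᵇ i)
≡ᵇ-sym zero    zero    = refl
≡ᵇ-sym zero    (suc j) = refl
≡ᵇ-sym (suc i) zero    = refl
≡ᵇ-sym (suc i) (suc j) = ≡ᵇ-sym i j

≤ᵇ-suc : ∀ i j → (suc i ≤ᵇ suc j) ≡ (i ≤ᵇ j)
≤ᵇ-suc zero    j = refl
≤ᵇ-suc (suc i) j = refl

ks : Adjacency Vertex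
ks (a i) (a j) = not (i ≡ᵇ j)
ks (a i) (b j) = j ≤ᵇ i
ks (b i) (a j) = i ≤ᵇ j
ks (b _) (b _) = false

ks-sym : Symmetric ks
ks-sym (a i) (a j) = cong not (≡ᵇ-sym i j)
ks-sym (a i) (b j) = refl
ks-sym (b i) (a j) = refl
ks-sym (b i) (b j) = refl

ks-irr : Irreflexive ks
ks-irr (a i) = cong not (≡ᵇ-refl i)
ks-irr (b i) = refl

ks-shift : ∀ x y → ks (shift x) (shift y) ≡ ks x y
ks-shift (a i) (a j) = refl
ks-shift (a i) (b j) = ≤ᵇ-suc j i
ks-shift (b i) (a j) = ≤ᵇ-suc i j
ks-shift (b i) (b j) = refl

ks-twins : ∀ x → ks (a 1) (shift (shift x)) ≡ ks (b 1) (shift (shift x))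
ks-twins (a i) = refl
ks-twins (b i) = refl

crossing : Part → Part → Bool
crossing clique stable = true
crossing stable clique = true
crossing _      _      = false

isB0 : Vertex → Bool
isB0 (b zero) = true
isB0 _        = false

isB0-false : ∀ {x} → x ≢ b 0 → isB0 x ≡ false
isB0-false {a i}       _     = refl
isB0-false {b zero}    x≢b0  = ⊥-elim (x≢b0 refl)
isB0-false {b (suc i)} _     = refl

-- Adding a rung: shift r by one and add a 0, b 0, which together with
-- the old b 0 (now b 1) form a triangle.
ladder : Adjacency Vertex → Adjacency Vertex
ladder r (p , zero)  (q , zero)  = crossing p q
ladder r (p , zero)  (q , suc j) = isB0 (q , j)
ladder r (p , suc i) (q , zero)  = isB0 (p , i)
ladder r (p , suc i) (q , suc j) = r (p , i) (q , j)

ladder-sym : ∀ {r} → Symmetric r → Symmetric (ladder r)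
ladder-sym r-sym (a zero)    (a zero)    = refl
ladder-sym r-sym (a zero)    (b zero)    = refl
ladder-sym r-sym (b zero)    (a zero)    = refl
ladder-sym r-sym (b zero)    (b zero)    = refl
ladder-sym r-sym (p , zero)  (q , suc j) = refl
ladder-sym r-sym (p , suc i) (q , zero)  = refl
ladder-sym r-sym (p , suc i) (q , suc j) = r-sym (p , i) (q , j)

ladder-irr : ∀ {r} → Irreflexive r → Irreflexive (ladder r)
ladder-irr r-irr (a zero)    = refl
ladder-irr r-irr (b zero)    = refl
ladder-irr r-irr (p , suc i) = r-irr (p , i)

-- The graph after k pivots: a ladder of k rungs on top of K_∞ ▷ S_∞.
stage : ℕ → Adjacency Vertex
stage zero    = ks
stage (suc k) = ladder (stage k)

stage-sym : ∀ k → Symmetric (stage k)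
stage-sym zero    = ks-sym
stage-sym (suc k) = ladder-sym (stage-sym k)

stage-irr : ∀ k → Irreflexive (stage k)
stage-irr zero    = ks-irr
stage-irr (suc k) = ladder-irr (stage-irr k)

base-row-u : ∀ y → y ≢ a 1 → y ≢ b 1 → ladder ks (a 1) y ≡ ks (b 1) y
base-row-u (a zero)          _   _   = refl
base-row-u (b zero)          _   _   = refl
base-row-u (a 1)             y≢a _   = ⊥-elim (y≢a refl)
base-row-u (b 1)             _   y≢b = ⊥-elim (y≢b refl)
base-row-u (a (suc (suc j))) _   _   = refl
base-row-u (b (suc (suc j))) _   _   = refl

base-row-v : ∀ y → y ≢ a 1 → y ≢ b 1 → ladder ks (b 1) y ≡ ks (a 1) y
base-row-v (a zero)          _   _   = refl
base-row-v (b zero)          _   _   = refl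
base-row-v (a 1)             y≢a _   = ⊥-elim (y≢a refl)
base-row-v (b 1)             _   y≢b = ⊥-elim (y≢b refl)
base-row-v (a (suc (suc j))) _   _   = refl
base-row-v (b (suc (suc j))) _   _   = refl

-- Pairs of index ≥ 2 are not toggled (twins), pairs meeting index 0 are
-- checked directly.
base-away : ∀ x y → x ≢ a 1 → x ≢ b 1 → y ≢ a 1 → y ≢ b 1 →
            ladder ks x y ≡ toggled ks (a 1) (b 1) x y
base-away (a 1) _     x≢a _   _   _   = ⊥-elim (x≢a refl)
base-away (b 1) _     _   x≢b _   _   = ⊥-elim (x≢b refl)
base-away _     (a 1) _   _   y≢a _   = ⊥-elim (y≢a refl)
base-away _     (b 1) _   _   _   y≢b = ⊥-elim (y≢b refl)
base-away (p , suc (suc i)) (q , suc (suc j)) _ _ _ _ =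
  trans (sym (ks-shift (p , suc i) (q , suc j)))
        (sym (toggled-twins ks (a 1) (b 1) (p , suc (suc i)) (q , suc (suc j)) (ks-twins (p , i)) (ks-twins (q , j))))
base-away (a zero)          (a zero)          _ _ _ _ = refl
base-away (a zero)          (b zero)          _ _ _ _ = refl
base-away (b zero)          (a zero)          _ _ _ _ = refl
base-away (b zero)          (b zero)          _ _ _ _ = refl
base-away (a zero)          (a (suc (suc j))) _ _ _ _ = refl
base-away (a zero)          (b (suc (suc j))) _ _ _ _ = refl
base-away (b zero)          (a (suc (suc j))) _ _ _ _ = refl
base-away (b zero)          (b (suc (suc j))) _ _ _ _ = refl
base-away (a (suc (suc i))) (a zero)          _ _ _ _ = refl
base-away (a (suc (suc i))) (b zero)          _ _ _ _ = refl
base-away (b (suc (suc i))) (a zero)          _ _ _ _ = refl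
base-away (b (suc (suc i))) (b zero)          _ _ _ _ = refl

base-pivot : IsPivot ks (stage 1) (a 1) (b 1)
base-pivot = record
  { edge = refl ; edge′ = refl ; row-u = base-row-u ; row-v = base-row-v
  ; away = λ x y _ → base-away x y }

-- Induction step: pivoting commutes with adding a rung, as long as the
-- pivot edge avoids b 0 (the only old vertex the new rung sees).
ladder-pivot : ∀ {r r′ u v} → IsPivot r r′ u v → u ≢ b 0 → v ≢ b 0 →
               IsPivot (ladder r) (ladder r′) (shift u) (shift v)
ladder-pivot {r} {r′} {u} {v} r-pivot u≢b0 v≢b0 = record
  { edge = edge r-pivot ; edge′ = edge′ r-pivot
  ; row-u = row-u-L ; row-v = row-v-L ; away = away-L }
  where
  unshift : ∀ {p i y} → (p , suc i) ≢ shift y → (p , i) ≢ y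
  unshift ne e = ne (cong shift e)

  new-unseen : ∀ {w} → w ≢ b 0 → ∀ p → ladder r (shift w) (p , zero) ≡ false
  new-unseen w≢b0 p = isB0-false w≢b0

  new-row : ∀ p y → ladder r′ (p , zero) y ≡ ladder r (p , zero) y
  new-row p (q , zero)  = refl
  new-row p (q , suc j) = refl

  row-u-L : ∀ y → y ≢ shift u → y ≢ shift v → ladder r′ (shift u) y ≡ ladder r (shift v) y
  row-u-L (q , zero)  _   _   = trans (isB0-false u≢b0) (sym (isB0-false v≢b0))
  row-u-L (q , suc j) y≢u y≢v = row-u r-pivot (q , j) (unshift y≢u) (unshift y≢v)

  row-v-L : ∀ y → y ≢ shift u → y ≢ shift v → ladder r′ (shift v) y ≡ ladder r (shift u) y
  row-v-L (q , zero)  _   _   = trans (isB0-false v≢b0) (sym (isB0-false u≢b0))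
  row-v-L (q , suc j) y≢u y≢v = row-v r-pivot (q , j) (unshift y≢u) (unshift y≢v)

  away-L : ∀ x y → x ≢ y → x ≢ shift u → x ≢ shift v → y ≢ shift u → y ≢ shift v →
           ladder r′ x y ≡ toggled (ladder r) (shift u) (shift v) x y
  away-L (p , zero) y _ _ _ _ _ =
    trans (new-row p y)
          (sym (toggled-unseenˡ (ladder r) (shift u) (shift v) (p , zero) y (new-unseen u≢b0 p) (new-unseen v≢b0 p)))
  away-L (p , suc i) (q , zero) _ _ _ _ _ =
    sym (toggled-unseenʳ (ladder r) (shift u) (shift v) (p , suc i) (q , zero) (new-unseen u≢b0 q) (new-unseen v≢b0 q))
  away-L (p , suc i) (q , suc j) x≢y x≢u x≢v y≢u y≢v =
    away r-pivot (p , i) (q , j) (unshift x≢y) (unshift x≢u) (unshift x≢v) (unshift y≢u) (unshift y≢v)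

stage-pivot : ∀ k → IsPivot (stage k) (stage (suc k)) (a (suc k)) (b (suc k))
stage-pivot zero    = base-pivot
stage-pivot (suc k) = ladder-pivot (stage-pivot k) (λ ()) (λ ())

consecutive : ℕ → ℕ → Bool
consecutive i j = (suc i ≡ᵇ j) ∨ (suc j ≡ᵇ i)

consecutive-irr : ∀ i → consecutive i i ≡ false
consecutive-irr i = cong₂ _∨_ (≡ᵇ-false (1+n≢n {i})) (≡ᵇ-false (1+n≢n {i}))

consecutive-sym : ∀ i j → consecutive i j ≡ consecutive j i
consecutive-sym i j = ∨-comm (suc i ≡ᵇ j) (suc j ≡ᵇ i)

stage-b-b : ∀ k s t → s ≤ k → t ≤ k → stage k (b s) (b t) ≡ consecutive s t
stage-b-b zero    zero          zero          _       _       = refl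
stage-b-b (suc k) zero          zero          _       _       = refl
stage-b-b (suc k) zero          (suc zero)    _       _       = refl
stage-b-b (suc k) zero          (suc (suc t)) _       _       = refl
stage-b-b (suc k) (suc zero)    zero          _       _       = refl
stage-b-b (suc k) (suc (suc s)) zero          _       _       = refl
stage-b-b (suc k) (suc s)       (suc t)       (s≤s p) (s≤s q) = stage-b-b k s t p q

stage-a-b : ∀ k t → t ≤ k → stage k (a k) (b t) ≡ consecutive (suc k) t
stage-a-b zero    zero    _       = refl
stage-a-b (suc k) zero    _       = refl
stage-a-b (suc k) (suc t) (s≤s p) = stage-a-b k t p

side : ∀ {n} → Fin n ⊎ Fin n → Vertex
side (inj₁ i) = a (toℕ i)
side (inj₂ j) = b (toℕ j)

label : (n : ℕ) → Fin (n + n) → Vertex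
label n x = side (splitAt n x)

side-injective : ∀ {n} {s t : Fin n ⊎ Fin n} → side s ≡ side t → s ≡ t
side-injective {s = inj₁ i} {inj₁ j} e = cong inj₁ (toℕ-injective (cong proj₂ e))
side-injective {s = inj₂ i} {inj₂ j} e = cong inj₂ (toℕ-injective (cong proj₂ e))
side-injective {s = inj₁ i} {inj₂ j} ()
side-injective {s = inj₂ i} {inj₁ j} ()

label-injective : ∀ n {x y} → label n x ≡ label n y → x ≡ y
label-injective n {x} {y} e = begin
  x                        ≡⟨ sym (join-splitAt n n x) ⟩
  join n n (splitAt n x)   ≡⟨ cong (join n n) (side-injective e) ⟩
  join n n (splitAt n y)   ≡⟨ join-splitAt n n y ⟩
  y                        ∎

label-↑ˡ : ∀ n (i : Fin n) → label n (i ↑ˡ n) ≡ a (toℕ i)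
label-↑ˡ n i = cong side (splitAt-↑ˡ n i n)

label-↑ʳ : ∀ n (j : Fin n) → label n (n ↑ʳ j) ≡ b (toℕ j)
label-↑ʳ n j = cong side (splitAt-↑ʳ n n j)

KS-described : ∀ n → Described (asGraphOn (KS n)) (label n) ks
KS-described n x y with splitAt n x | splitAt n y
... | inj₁ i | inj₁ j with i ≟ j
...   | yes refl = sym (ks-irr (a (toℕ i)))
...   | no  i≢j  = sym (cong not (≡ᵇ-false (i≢j ∘ toℕ-injective)))
KS-described n x y | inj₁ i | inj₂ j = refl
KS-described n x y | inj₂ i | inj₁ j = refl
KS-described n x y | inj₂ i | inj₂ j = refl

next-stage : ∀ n k → suc k < n → (G : GraphOn (n + n)) → Described G (label n) (stage k) →
             Σ (GraphOn (n + n)) λ G′ → PivotMinor (graph G′) (graph G) × Described G′ (label n) (stage (suc k))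
next-stage n k k+1<n G G≈stage =
  pivotOn G u v ,
  pivot-step (label-injective n) (stage-sym (suc k)) (stage-irr (suc k)) G u v r-pivot G≈stage
  where
  i = fromℕ< k+1<n
  u = i ↑ˡ n
  v = n ↑ʳ i
  r-pivot : IsPivot (stage k) (stage (suc k)) (label n u) (label n v)
  r-pivot = subst₂ (IsPivot (stage k) (stage (suc k)))
              (sym (trans (label-↑ˡ n i) (cong a (toℕ-fromℕ< k+1<n))))
              (sym (trans (label-↑ʳ n i) (cong b (toℕ-fromℕ< k+1<n))))
              (stage-pivot k)

reach-stage : ∀ n k → k < n →
              Σ (GraphOn (n + n)) λ G → PivotMinor (graph G) (KS n) × Described G (label n) (stage k)
reach-stage n zero    _     = asGraphOn (KS n) , pm-refl , KS-described n
reach-stage n (suc k) k+1<n with reach-stage n k (<⇒≤ k+1<n)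
... | G , G≼KS , G≈stage with next-stage n k k+1<n G G≈stage
...   | G′ , G′≼G , G′≈stage = G′ , pm-trans G′≼G G≼KS , G′≈stage

-- Deleting the first j vertices of a graph on Fin (1 + j + m) leaves the
-- induced subgraph on the vertices embed j x.
embed : ∀ j {m} → Fin (suc m) → Fin (suc (j + m))
embed zero    x = x
embed (suc j) x = suc (embed j x)

embed-zero : ∀ j {m} → embed j {m} zero ≡ fromℕ j ↑ˡ m
embed-zero zero    = refl
embed-zero (suc j) = cong suc (embed-zero j)

embed-suc : ∀ j {m} (t : Fin m) → embed j (suc t) ≡ suc (j ↑ʳ t)
embed-suc zero    t = refl
embed-suc (suc j) t = cong suc (embed-suc j t)

tailOn : ∀ {m} → GraphOn (suc m) → GraphOn m
tailOn G = record
  { rel = λ x y → rel G (suc x) (suc y)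
  ; rel-sym = λ x y → rel-sym G (suc x) (suc y)
  ; rel-irr = λ x → rel-irr G (suc x) }

dropOn : ∀ j {m} → GraphOn (suc (j + m)) → GraphOn (suc m)
dropOn j G = record
  { rel = λ x y → rel G (embed j x) (embed j y)
  ; rel-sym = λ x y → rel-sym G (embed j x) (embed j y)
  ; rel-irr = λ x → rel-irr G (embed j x) }

drop-minor : ∀ j {m} (G : GraphOn (suc (j + m))) → PivotMinor (graph (dropOn j G)) (graph G)
drop-minor zero    G = pm-refl
drop-minor (suc j) G = pm-delete refl zero (drop-minor j (tailOn G))

-- The surviving vertices a k, b 0, …, b k, and their places on the path.
endLabel : ∀ k → Fin (suc (suc k)) → Vertex
endLabel k zero    = a k
endLabel k (suc t) = b (toℕ t)

endPosition : ∀ k → Fin (suc (suc k)) → ℕ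
endPosition k zero    = suc k
endPosition k (suc t) = toℕ t

endLabel-embed : ∀ k x → label (suc k) (embed k x) ≡ endLabel k x
endLabel-embed k zero = begin
  label (suc k) (embed k zero)          ≡⟨ cong (label (suc k)) (embed-zero k) ⟩
  label (suc k) (fromℕ k ↑ˡ suc k)      ≡⟨ label-↑ˡ (suc k) (fromℕ k) ⟩
  a (toℕ (fromℕ k))                     ≡⟨ cong a (toℕ-fromℕ k) ⟩
  a k                                   ∎
endLabel-embed k (suc t) =
  trans (cong (label (suc k)) (embed-suc k t)) (label-↑ʳ (suc k) t)

path-shape : ∀ k x y → stage k (endLabel k x) (endLabel k y) ≡ consecutive (endPosition k x) (endPosition k y)
path-shape k zero    zero    = trans (stage-irr k (a k)) (sym (consecutive-irr (suc k)))
path-shape k zero    (suc t) = stage-a-b k (toℕ t) (s≤s⁻¹ (toℕ<n t))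
path-shape k (suc s) zero    =
  trans (stage-sym k (b (toℕ s)) (a k))
        (trans (stage-a-b k (toℕ s) (s≤s⁻¹ (toℕ<n s))) (consecutive-sym (suc k) (toℕ s)))
path-shape k (suc s) (suc t) = stage-b-b k (toℕ s) (toℕ t) (s≤s⁻¹ (toℕ<n s)) (s≤s⁻¹ (toℕ<n t))

-- The rotation 0 ↦ m, t + 1 ↦ t, moving a k to the end of the path.
rotate : ∀ m → Permutation (suc m) (suc m)
rotate m = insert zero (fromℕ m) id

toℕ-punchIn-fromℕ : ∀ {m} (t : Fin m) → toℕ (punchIn (fromℕ m) t) ≡ toℕ t
toℕ-punchIn-fromℕ zero    = refl
toℕ-punchIn-fromℕ (suc t) = cong suc (toℕ-punchIn-fromℕ t)

rotate-position : ∀ k x → toℕ (rotate (suc k) ⟨$⟩ʳ x) ≡ endPosition k x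
rotate-position k zero    = toℕ-fromℕ (suc k)
rotate-position k (suc t) =
  trans (cong toℕ (insert-punchIn zero (fromℕ (suc k)) id t)) (toℕ-punchIn-fromℕ t)

end-path : ∀ k (H : GraphOn (suc (suc k))) → Described H (endLabel k) (stage k) →
           graph H ≅ P (suc (suc k))
end-path k H H≈stage = record { bij = rotate (suc k) ; preserves = preserves }
  where
  preserves : ∀ x y → PAdj (suc (suc k)) (rotate (suc k) ⟨$⟩ʳ x) (rotate (suc k) ⟨$⟩ʳ y) ≡ rel H x y
  preserves x y = begin
    consecutive (toℕ (rotate (suc k) ⟨$⟩ʳ x)) (toℕ (rotate (suc k) ⟨$⟩ʳ y))
      ≡⟨ cong₂ consecutive (rotate-position k x) (rotate-position k y) ⟩
    consecutive (endPosition k x) (endPosition k y)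
      ≡⟨ sym (path-shape k x y) ⟩
    stage k (endLabel k x) (endLabel k y)
      ≡⟨ sym (H≈stage x y) ⟩
    rel H x y ∎

lemma5p6 : (n : ℕ) → n ≥ 1 → Σ Graph (λ H → PivotMinor H (KS n) × (H ≅ P (suc n)))
lemma5p6 zero ()
lemma5p6 (suc k) _ with reach-stage (suc k) k (n<1+n k)
... | G , G≼KS , G≈stage =
  graph H , pm-trans (drop-minor k G) G≼KS , end-path k H H≈stage
  where
  H = dropOn k G
  H≈stage : Described H (endLabel k) (stage k)
  H≈stage x y = trans (G≈stage (embed k x) (embed k y))
                      (cong₂ (stage k) (endLabel-embed k x) (endLabel-embed k y))
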